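{- Let $\Sigma\subseteq\mathcal L$ be closed under subformulas, let $\mathcal W=(W,\le,\ell,R)$ be a $\Sigma$-labelled system, and let $\mathcal Q=(W/{\sim},\le_{\mathcal Q},\ell_{\mathcal Q},R^+_{\mathcal Q})$ be its quotient, defined as follows: $L(w)=\{\ell(v): v\le w\text{ or }w\le v\}$; $w\sim v$ iff $(\ell(w),L(w))=(\ell(v),L(v))$; $[w]\le_{\mathcal Q}[v]$ iff $L(w)=L(v)$ and $\ell(w)\supseteq\ell(v)$; $\ell_{\mathcal Q}([w])=\ell(w)$; $R_{\mathcal Q}$ is the smallest relation with $wRv\Rightarrow[w]R_{\mathcal Q}[v]$; $XR^+_{\mathcal Q}Y$ iff there exist $X_1\le_{\mathcal Q}X\le_{\mathcal Q}X_2$, $Y_1\le_{\mathcal Q}Y\le_{\mathcal Q}Y_2$ with $X_2R_{\mathcal Q}Y_1$ and $X_1R_{\mathcal Q}Y_2$. If $R$ is $\omega$-sensible, then $R^+_{\mathcal Q}$ is $\omega$-sensible (with respect to $\ell_{\mathcal Q}$).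
   Context: The language $\mathcal L$ over a countably infinite set of variables: $\varphi ::= p\mid\varphi\wedge\psi\mid\varphi\vee\psi\mid\varphi\Rightarrow\psi\mid\varphi\Leftarrow\psi\mid\mathsf X\varphi\mid\mathsf Y\varphi\mid\mathsf G\varphi\mid\mathsf H\varphi\mid\varphi\,\mathsf U\,\psi\mid\varphi\,\mathsf S\,\psi$. Let $\Sigma\subseteq\mathcal L$ be closed under subformulas. A $\Sigma$-type is $\Phi\subseteq\Sigma$ such that: if $\varphi\wedge\psi\in\Sigma$ then ($\varphi\wedge\psi\in\Phi$ iff $\varphi,\psi\in\Phi$); if $\varphi\vee\psi\in\Sigma$ then ($\varphi\vee\psi\in\Phi$ iff $\varphi\in\Phi$ or $\psi\in\Phi$); if $\varphi\Rightarrow\psi\in\Sigma$ then $\varphi\Rightarrow\psi\in\Phi$ implies ($\varphi\notin\Phi$ or $\psi\in\Phi$), and $\psi\in\Phi$ implies $\varphi\Rightarrow\psi\in\Phi$; if $\varphi\Leftarrow\psi\in\Sigma$ then $\varphi\Leftarrow\psi\in\Phi$ implies $\varphi\in\Phi$, and ($\varphi\in\Phi$ and $\psi\notin\Phi$) implies $\varphi\Leftarrow\psi\in\Phi$. A poset is locally linear if it is a disjoint union of linear posets. A $\Sigma$-labelled space is $(W,\le,\ell)$ with $(W,\le)$ locally linear, $\ell:W\to\{\Sigma\text{ -types}\}$ with $w\le v\Rightarrow\ell(w)\supseteq\ell(v)$, such that for all $w$: if $\varphi\Rightarrow\psi\in\Sigma\setminus\ell(w)$ there is $v\le w$ with $\varphi\in\ell(v)$,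 $\psi\notin\ell(v)$; if $\varphi\Leftarrow\psi\in\ell(w)$ there is $v\ge w$ with $\varphi\in\ell(v)$, $\psi\notin\ell(v)$. A relation $R\subseteq W\times W$ is convex if for every $x$ the sets $\{y:xRy\}$ and $\{y:yRx\}$ are convex w.r.t. $\le$. It is fully confluent if: (forth–down) $x\le x'Ry'$ implies $\exists y$ with $xRy\le y'$; (forth–up) $x'\ge xRy$ implies $\exists y'$ with $x'Ry'\ge y$; (back–down) $x'Ry'\ge y$ implies $\exists x$ with $x'\ge xRy$; (back–up) $xRy\le y'$ implies $\exists x'$ with $x\le x'Ry'$. A pair of $\Sigma$-types $(\Phi,\Psi)$ is sensible if: $\mathsf X\varphi\in\Phi\iff\varphi\in\Psi$; $\mathsf Y\varphi\in\Psi\iff\varphi\in\Phi$; $\mathsf G\varphi\in\Phi\iff(\varphi\in\Phi$ and $\mathsf G\varphi\in\Psi)$; $\mathsf H\varphi\in\Psi\iff(\varphi\in\Psi$ and $\mathsf H\varphi\in\Phi)$; $\varphi\,\mathsf U\,\psi\in\Phi\iff(\psi\in\Phi$ or ($\varphi\in\Phi$ and $\varphi\,\mathsf U\,\psi\in\Psi$)); $\varphi\,\mathsf S\,\psi\in\Psi\iff(\psi\in\Psi$ or ($\varphi\in\Psi$ and $\varphi\,\mathsf S\,\psi\in\Phi$)), for all such formulas in $\Sigma$. $R$ is sensible if $(\ell(w),\ell(v))$ is sensible whenever $wRv$; bi-serial if every element has an $R$-successor and an $R$-predecessor. A $\Sigma$-labelled system is a $\Sigma$-labelled space equipped with a bi-serial,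 fully confluent, convex, sensible relation. A relation $R$ on a labelled structure with labelling $\ell$ is $\omega$-sensible if: $\mathsf G\varphi\in\Sigma\setminus\ell(w)$ implies $\exists n\ge0,v$ with $wR^nv$, $\varphi\notin\ell(v)$; $\mathsf H\varphi\in\Sigma\setminus\ell(w)$ implies $\exists n\ge0,v$ with $vR^nw$, $\varphi\notin\ell(v)$; $\varphi\,\mathsf U\,\psi\in\ell(w)$ implies $\exists n\ge0,v$ with $wR^nv$, $\psi\in\ell(v)$; $\varphi\,\mathsf S\,\psi\in\ell(w)$ implies $\exists n\ge0,v$ with $vR^nw$, $\psi\in\ell(v)$. -}

module Defs where

open import Data.Nat using (ℕ; zero; suc)
open import Data.Product using (Σ; _×_; _,_; ∃; ∃-syntax)
open import Data.Sum using (_⊎_)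
open import Relation.Nullary using (¬_)
open import Relation.Binary.PropositionalEquality using (_≡_)

infixr 6 _∧'_ _∨'_
infixr 5 _⇒'_ _⇐'_ _U'_ _S'_

data Formula : Set where
  var  : ℕ → Formula
  _∧'_ _∨'_ _⇒'_ _⇐'_ : Formula → Formula → Formula
  X' Y' G' H' : Formula → Formula
  _U'_ _S'_ : Formula → Formula → Formula

FSet : Set₁
FSet = Formula → Set

_⊆_ : FSet → FSet → Set
A ⊆ B = ∀ φ → A φ → B φ

_≐_ : FSet → FSet → Set
A ≐ B = A ⊆ B × B ⊆ A

_↔_ : Set → Set → Set
A ↔ B = (A → B) × (B → A)

data ImmSub : Formula → Formula → Set where
  ∧l : ∀ {φ ψ} → ImmSub φ (φ ∧' ψ)
  ∧r : ∀ {φ ψ} → ImmSub ψ (φ ∧' ψ)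
  ∨l : ∀ {φ ψ} → ImmSub φ (φ ∨' ψ)
  ∨r : ∀ {φ ψ} → ImmSub ψ (φ ∨' ψ)
  ⇒l : ∀ {φ ψ} → ImmSub φ (φ ⇒' ψ)
  ⇒r : ∀ {φ ψ} → ImmSub ψ (φ ⇒' ψ)
  ⇐l : ∀ {φ ψ} → ImmSub φ (φ ⇐' ψ)
  ⇐r : ∀ {φ ψ} → ImmSub ψ (φ ⇐' ψ)
  Xs : ∀ {φ} → ImmSub φ (X' φ)
  Ys : ∀ {φ} → ImmSub φ (Y' φ)
  Gs : ∀ {φ} → ImmSub φ (G' φ)
  Hs : ∀ {φ} → ImmSub φ (H' φ)
  Ul : ∀ {φ ψ} → ImmSub φ (φ U' ψ)
  Ur : ∀ {φ ψ} → ImmSub ψ (φ U' ψ)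
  Sl : ∀ {φ ψ} → ImmSub φ (φ S' ψ)
  Sr : ∀ {φ ψ} → ImmSub ψ (φ S' ψ)

SubClosed : FSet → Set
SubClosed Σ' = ∀ φ χ → ImmSub φ χ → Σ' χ → Σ' φ

record IsType (Σ' : FSet) (Φ : FSet) : Set where
  field
    sub : Φ ⊆ Σ'
    ∧-ax : ∀ φ ψ → Σ' (φ ∧' ψ) → Φ (φ ∧' ψ) ↔ (Φ φ × Φ ψ)
    ∨-ax : ∀ φ ψ → Σ' (φ ∨' ψ) → Φ (φ ∨' ψ) ↔ (Φ φ ⊎ Φ ψ)
    ⇒-ax₁ : ∀ φ ψ → Σ' (φ ⇒' ψ) → Φ (φ ⇒' ψ) → ¬ Φ φ ⊎ Φ ψ
    ⇒-ax₂ : ∀ φ ψ → Σ' (φ ⇒' ψ) → Φ ψ → Φ (φ ⇒' ψ)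
    ⇐-ax₁ : ∀ φ ψ → Σ' (φ ⇐' ψ) → Φ (φ ⇐' ψ) → Φ φ
    ⇐-ax₂ : ∀ φ ψ → Σ' (φ ⇐' ψ) → Φ φ → ¬ Φ ψ → Φ (φ ⇐' ψ)

Comp : {W : Set} → (W → W → Set) → W → W → Set
Comp _≤_ x y = x ≤ y ⊎ y ≤ x

-- locally linear poset: partial order which is a disjoint union of linear
-- orders, i.e. comparability is transitive (an equivalence whose classes are chains)
record LocallyLinear (W : Set) (_≤_ : W → W → Set) : Set where
  field
    refl≤  : ∀ x → x ≤ x
    trans≤ : ∀ {x y z} → x ≤ y → y ≤ z → x ≤ z
    antisym≤ : ∀ {x y} → x ≤ y → y ≤ x → x ≡ y
    compTrans : ∀ {x y z} → Comp _≤_ x y → Comp _≤_ y z → Comp _≤_ x z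

record LabelledSpace (Σ' : FSet) (W : Set) (_≤_ : W → W → Set) (ℓ : W → FSet) : Set where
  field
    locLin : LocallyLinear W _≤_
    isType : ∀ w → IsType Σ' (ℓ w)
    mono   : ∀ {w v} → w ≤ v → ℓ v ⊆ ℓ w
    ⇒-wit  : ∀ w φ ψ → Σ' (φ ⇒' ψ) → ¬ ℓ w (φ ⇒' ψ) →
             ∃[ v ] (v ≤ w × ℓ v φ × ¬ ℓ v ψ)
    ⇐-wit  : ∀ w φ ψ → ℓ w (φ ⇐' ψ) →
             ∃[ v ] (w ≤ v × ℓ v φ × ¬ ℓ v ψ)

Convex : {W : Set} → (W → W → Set) → (W → W → Set) → Set
Convex {W} _≤_ R =
  (∀ x y₁ y y₂ → y₁ ≤ y → y ≤ y₂ → R x y₁ → R x y₂ → R x y) ×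
  (∀ x y₁ y y₂ → y₁ ≤ y → y ≤ y₂ → R y₁ x → R y₂ x → R y x)

record FullyConfluent {W : Set} (_≤_ : W → W → Set) (R : W → W → Set) : Set where
  field
    forthDown : ∀ x x' y' → x ≤ x' → R x' y' → ∃[ y ] (R x y × y ≤ y')
    forthUp   : ∀ x x' y → x ≤ x' → R x y → ∃[ y' ] (R x' y' × y ≤ y')
    backDown  : ∀ x' y' y → R x' y' → y ≤ y' → ∃[ x ] (x ≤ x' × R x y)
    backUp    : ∀ x y y' → R x y → y ≤ y' → ∃[ x' ] (x ≤ x' × R x' y')

record SensiblePair (Σ' : FSet) (Φ Ψ : FSet) : Set where
  field
    X-ax : ∀ φ → Σ' (X' φ) → Φ (X' φ) ↔ Ψ φ
    Y-ax : ∀ φ → Σ' (Y' φ) → Ψ (Y' φ) ↔ Φ φ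
    G-ax : ∀ φ → Σ' (G' φ) → Φ (G' φ) ↔ (Φ φ × Ψ (G' φ))
    H-ax : ∀ φ → Σ' (H' φ) → Ψ (H' φ) ↔ (Ψ φ × Φ (H' φ))
    U-ax : ∀ φ ψ → Σ' (φ U' ψ) → Φ (φ U' ψ) ↔ (Φ ψ ⊎ (Φ φ × Ψ (φ U' ψ)))
    S-ax : ∀ φ ψ → Σ' (φ S' ψ) → Ψ (φ S' ψ) ↔ (Ψ ψ ⊎ (Ψ φ × Φ (φ S' ψ)))

record LabelledSystem (Σ' : FSet) (W : Set) (_≤_ : W → W → Set) (ℓ : W → FSet)
                      (R : W → W → Set) : Set where
  field
    space    : LabelledSpace Σ' W _≤_ ℓ
    serialF  : ∀ w → ∃[ v ] R w v
    serialB  : ∀ w → ∃[ v ] R v w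
    confluent : FullyConfluent _≤_ R
    convex   : Convex _≤_ R
    sensible : ∀ w v → R w v → SensiblePair Σ' (ℓ w) (ℓ v)

-- n-fold iterate of R, where the 0-th power is the identity relation _≈_
-- of the underlying set (propositional equality on W, the class equality ∼ on W/∼)
Pow : {W : Set} → (W → W → Set) → (W → W → Set) → ℕ → W → W → Set
Pow _≈_ R zero x y = x ≈ y
Pow _≈_ R (suc n) x y = ∃[ z ] (R x z × Pow _≈_ R n z y)

record OmegaSensible (Σ' : FSet) {W : Set} (_≈_ : W → W → Set) (ℓ : W → FSet)
                     (R : W → W → Set) : Set where
  field
    G-ω : ∀ w φ → Σ' (G' φ) → ¬ ℓ w (G' φ) →
          ∃[ n ] ∃[ v ] (Pow _≈_ R n w v × ¬ ℓ v φ)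
    H-ω : ∀ w φ → Σ' (H' φ) → ¬ ℓ w (H' φ) →
          ∃[ n ] ∃[ v ] (Pow _≈_ R n v w × ¬ ℓ v φ)
    U-ω : ∀ w φ ψ → ℓ w (φ U' ψ) →
          ∃[ n ] ∃[ v ] (Pow _≈_ R n w v × ℓ v ψ)
    S-ω : ∀ w φ ψ → ℓ w (φ S' ψ) →
          ∃[ n ] ∃[ v ] (Pow _≈_ R n v w × ℓ v ψ)

-- The quotient, represented on representatives (setoid style):
-- classes [w] are represented by elements w ∈ W, all relations below are
-- invariant under ∼, and _∼_ plays the role of equality of classes.

module Quotient {W : Set} (_≤_ : W → W → Set) (ℓ : W → FSet) (R : W → W → Set) where

  LMem : W → FSet → Set
  LMem w Φ = ∃[ v ] (Comp _≤_ v w × ℓ v ≐ Φ)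

  -- L(w) = L(v)  (as sets of types, types compared extensionally)
  SameL : W → W → Set
  SameL w v = (∀ u → Comp _≤_ u w → LMem v (ℓ u)) ×
              (∀ u → Comp _≤_ u v → LMem w (ℓ u))

  _∼_ : W → W → Set
  w ∼ v = (ℓ w ≐ ℓ v) × SameL w v

  _≤Q_ : W → W → Set
  w ≤Q v = SameL w v × ℓ v ⊆ ℓ w

  ℓQ : W → FSet
  ℓQ w = ℓ w

  RQ : W → W → Set
  RQ x y = ∃[ w ] ∃[ v ] (x ∼ w × y ∼ v × R w v)

  R⁺Q : W → W → Set
  R⁺Q x y = ∃[ x₁ ] ∃[ x₂ ] ∃[ y₁ ] ∃[ y₂ ]
              (x₁ ≤Q x × x ≤Q x₂ × y₁ ≤Q y × y ≤Q y₂ × RQ x₂ y₁ × RQ x₁ y₂)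

-- Every R-step w R v is also an R⁺_Q-step between the representatives w and v
-- (take X₁ = X₂ = [w] and Y₁ = Y₂ = [v]), and ℓ_Q is ℓ on representatives; so
-- each R-path witnessing ω-sensibility of R is already an R⁺_Q-path carrying the
-- same labels. In particular only R ⊆ R⁺_Q is used, not the properties of a
-- labelled system.
module Submission where

open import Defs
open import Data.Nat using (ℕ; zero; suc)
open import Data.Product using (_×_; _,_; ∃-syntax)
open import Relation.Binary.Core using (_⇒_)
open import Relation.Binary.PropositionalEquality using (_≡_; refl)

≐-refl : (A : FSet) → A ≐ A
≐-refl A = (λ φ x → x) , (λ φ x → x)

Pow-mono : {W : Set} {_≈_ _≈'_ R S : W → W → Set} →
           _≈_ ⇒ _≈'_ → R ⇒ S → ∀ n → Pow _≈_ R n ⇒ Pow _≈'_ S n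
Pow-mono ≈⇒≈' R⇒S zero    x≈y           = ≈⇒≈' x≈y
Pow-mono ≈⇒≈' R⇒S (suc n) (z , xRz , p) = z , R⇒S xRz , Pow-mono ≈⇒≈' R⇒S n p

OmegaSensible-mono : {Σ' : FSet} {W : Set} {_≈_ _≈'_ R S : W → W → Set} {ℓ : W → FSet} →
                     _≈_ ⇒ _≈'_ → R ⇒ S →
                     OmegaSensible Σ' _≈_ ℓ R → OmegaSensible Σ' _≈'_ ℓ S
OmegaSensible-mono {W = W} {_≈_} {_≈'_} {R} {S} ≈⇒≈' R⇒S om = record
  { G-ω = λ w φ s ¬Gφ → forward (G-ω w φ s ¬Gφ)
  ; H-ω = λ w φ s ¬Hφ → backward (H-ω w φ s ¬Hφ)
  ; U-ω = λ w φ ψ φUψ → forward (U-ω w φ ψ φUψ)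
  ; S-ω = λ w φ ψ φSψ → backward (S-ω w φ ψ φSψ)
  }
  where
  open OmegaSensible om

  forward : ∀ {w} {P : W → Set} →
            ∃[ n ] ∃[ v ] (Pow _≈_ R n w v × P v) → ∃[ n ] ∃[ v ] (Pow _≈'_ S n w v × P v)
  forward (n , v , p , q) = n , v , Pow-mono ≈⇒≈' R⇒S n p , q

  backward : ∀ {w} {P : W → Set} →
             ∃[ n ] ∃[ v ] (Pow _≈_ R n v w × P v) → ∃[ n ] ∃[ v ] (Pow _≈'_ S n v w × P v)
  backward (n , v , p , q) = n , v , Pow-mono ≈⇒≈' R⇒S n p , q

module QuotientProperties {W : Set} (_≤_ : W → W → Set) (ℓ : W → FSet) (R : W → W → Set) where
  open Quotient _≤_ ℓ R

  SameL-refl : ∀ w → SameL w w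
  SameL-refl w = (λ u u≶w → u , u≶w , ≐-refl (ℓ u)) , (λ u u≶w → u , u≶w , ≐-refl (ℓ u))

  ∼-refl : ∀ w → w ∼ w
  ∼-refl w = ≐-refl (ℓ w) , SameL-refl w

  ≡⇒∼ : _≡_ ⇒ _∼_
  ≡⇒∼ refl = ∼-refl _

  ≤Q-refl : ∀ w → w ≤Q w
  ≤Q-refl w = SameL-refl w , (λ φ x → x)

  R⇒RQ : R ⇒ RQ
  R⇒RQ {w} {v} wRv = w , v , ∼-refl w , ∼-refl v , wRv

  RQ⇒R⁺Q : RQ ⇒ R⁺Q
  RQ⇒R⁺Q {x} {y} xRQy = x , x , y , y , ≤Q-refl x , ≤Q-refl x , ≤Q-refl y , ≤Q-refl y , xRQy , xRQy

  R⇒R⁺Q : R ⇒ R⁺Q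
  R⇒R⁺Q wRv = RQ⇒R⁺Q (R⇒RQ wRv)

lemma6p3 : (Σ' : FSet) → SubClosed Σ' →
           (W : Set) (_≤_ : W → W → Set) (ℓ : W → FSet) (R : W → W → Set) →
           LabelledSystem Σ' W _≤_ ℓ R →
           OmegaSensible Σ' _≡_ ℓ R →
           OmegaSensible Σ' (Quotient._∼_ _≤_ ℓ R) (Quotient.ℓQ _≤_ ℓ R) (Quotient.R⁺Q _≤_ ℓ R)
lemma6p3 Σ' _ W _≤_ ℓ R _ = OmegaSensible-mono ≡⇒∼ R⇒R⁺Q
  where open QuotientProperties _≤_ ℓ R
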